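{- Let $\mathcal{P}=(\mathcal{P}^L,\mathcal{P}^F)$ be a symmetric leader protocol with associated Petri net $\mathcal{N}$ (transition set $T$, incidence matrix $\mathcal{A}$). Let $C$ be a configuration and $\mathbf{x}\in\mathbb{N}^T$ such that $(C,\mathbf{x})$ is compatible and $C(q)\ge2\|\mathbf{x}\|$ for every $q\in Q^F$. Then there are a configuration $D$ and a firing sequence $\xi\in T^*$ of $\mathcal{N}$ such that $C\xrightarrow{\xi}D$ and $\mathcal{P}(\xi)=\mathbf{x}$.
   Context: A rendez-vous protocol $(Q,\Sigma,\mathit{init},\mathit{fin},R)$ has finite $Q$, finite alphabet $\Sigma$, $\mathit{init},\mathit{fin}\in Q$, $R\subseteq Q\times\{!a,?a:a\in\Sigma\}\times Q$; it is symmetric if $(q,!a,q')\in R\iff(q,?a,q')\in R$. A symmetric leader protocol is $\mathcal{P}=(\mathcal{P}^L,\mathcal{P}^F)$ with symmetric $\mathcal{P}^L=(Q^L,\Sigma,\mathit{init}^L,\mathit{fin}^L,R^L)$ and $\mathcal{P}^F=(Q^F,\Sigma,\mathit{init}^F,\mathit{fin}^F,R^F)$, $Q^L\cap Q^F=\emptyset$. A configuration is a multiset $C$ over $Q^L\cup Q^F$ with $\sum_{q\in Q^L}C(q)=1$; $\mathrm{lead}(C)$ is the unique $q\in Q^L$ with $C(q)>0$. The net $\mathcal{N}=(P,T,\mathrm{Pre},\mathrm{Post})$ has $P=Q^L\cup Q^F$ and, for each $a\in\Sigma$ and rules $r=(q,!a,s),r'=(q',?a,s')\in R^L\cup R^F$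 not both in $R^L$, a transition $t_{r,r'}$ with $\mathrm{Pre}$-column the multiset $\langle q,q'\rangle$ and $\mathrm{Post}$-column $\langle s,s'\rangle$; $\mathcal{A}=\mathrm{Post}-\mathrm{Pre}$. Firing: $M\xrightarrow{t}M'$ if $M(p)\ge\mathrm{Pre}[p,t]$ for all $p$ and $M'=M+\mathcal{A}[\cdot,t]$, extended to sequences; configurations are markings. $t_{r,r'}$ is a leader transition if exactly one of $r,r'$ is in $R^L$; then $t.\mathit{from}$ is the unique place in $Q^L$ with $\mathrm{Pre}[\cdot,t]>0$ and $t.\mathit{to}$ the unique place in $Q^L$ with $\mathrm{Post}[\cdot,t]>0$. For $\mathbf{x}\in\mathbb{N}^T$, $\mathcal{G}(\mathbf{x})$ is the directed graph with vertices $\{t.\mathit{from},t.\mathit{to}\}$ and edges $(t.\mathit{from},t.\mathit{to})$ over all leader transitions $t$ with $\mathbf{x}[t]>0$. A pair $(C,\mathbf{x})$ is compatible if $C+\mathcal{A}\mathbf{x}\ge\mathbf{0}$ and every vertex of $\mathcal{G}(\mathbf{x})$ is reachable from $\mathrm{lead}(C)$ in $\mathcal{G}(\mathbf{x})$. $\|\mathbf{x}\|=\sum_t\mathbf{x}(t)$; $\mathcal{P}(\xi)$ is the Parikh image (occurrence counts) of $\xi$. -}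

module Defs where

open import Data.Bool using (Bool; true; false; _∧_; not; T; if_then_else_)
open import Data.Bool.Properties using (T?)
open import Data.Nat as ℕ using (ℕ; zero; suc; _≤_; _<_)
open import Data.Integer as ℤ using (ℤ; +_; 0ℤ)
open import Data.Fin using (Fin)
import Data.Fin.Properties as FinP
open import Data.Sum using (_⊎_; inj₁; inj₂)
import Data.Sum.Properties as SumP
open import Data.Product using (Σ; _×_; _,_; proj₁; proj₂)
import Data.Product.Properties as ProdP
open import Data.List using (List; []; _∷_; map; _++_; concatMap; mapMaybe; filter; length; foldr; allFin)
import Data.List as L
open import Data.Nat.ListAction using (sum)
open import Data.Maybe using (Maybe; just; nothing)
open import Relation.Nullary using (yes; no; does)
open import Relation.Binary.PropositionalEquality using (_≡_)
open import Relation.Binary.Definitions using (DecidableEquality)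

data Pol : Set where
  snd rcv : Pol

-- A symmetric rendez-vous protocol with n states (Fin n) over alphabet Fin k.
-- R q π a q' = true  iff  (q, πa, q') ∈ R.
record SymProtocol (n k : ℕ) : Set where
  field
    init fin : Fin n
    R : Fin n → Pol → Fin k → Fin n → Bool
    symmetric : ∀ q a q' → R q snd a q' ≡ R q rcv a q'

-- A symmetric leader protocol (P^L, P^F) over a common alphabet Fin k.
-- Q^L = Fin nL and Q^F = Fin nF, made disjoint as inj₁ / inj₂ in Q = Fin nL ⊎ Fin nF.
record LeaderProtocol : Set where
  field
    k nL nF : ℕ
    PL : SymProtocol nL k
    PF : SymProtocol nF k

module _ (𝒫 : LeaderProtocol) where
  open LeaderProtocol 𝒫

  Q : Set
  Q = Fin nL ⊎ Fin nF

  _≟Q_ : DecidableEquality Q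
  _≟Q_ = SumP.≡-dec FinP._≟_ FinP._≟_

  isL : Q → Bool
  isL (inj₁ _) = true
  isL (inj₂ _) = false

  RuleIn : Q → Pol → Fin k → Q → Bool
  RuleIn (inj₁ q) π a (inj₁ s) = SymProtocol.R PL q π a s
  RuleIn (inj₂ q) π a (inj₂ s) = SymProtocol.R PF q π a s
  RuleIn _ _ _ _ = false

  -- (a, q, s, q', s') encodes the pair r = (q,!a,s), r' = (q',?a,s')
  Key : Set
  Key = Fin k × Q × Q × Q × Q

  _≟K_ : DecidableEquality Key
  _≟K_ = ProdP.≡-dec FinP._≟_ (ProdP.≡-dec _≟Q_ (ProdP.≡-dec _≟Q_ (ProdP.≡-dec _≟Q_ _≟Q_)))

  valid : Key → Bool
  valid (a , q , s , q' , s') =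
    RuleIn q snd a s ∧ RuleIn q' rcv a s' ∧ not (isL q ∧ isL q')

  Tr : Set
  Tr = Σ Key (λ κ → T (valid κ))

  key : Tr → Key
  key = proj₁

  allQ : List Q
  allQ = map inj₁ (allFin nL) ++ map inj₂ (allFin nF)

  allKeys : List Key
  allKeys = concatMap (λ a → concatMap (λ q → concatMap (λ s → concatMap (λ q' →
              map (λ s' → (a , q , s , q' , s')) allQ) allQ) allQ) allQ) (allFin k)

  toTr : Key → Maybe Tr
  toTr κ with T? (valid κ)
  ... | yes p = just (κ , p)
  ... | no _  = nothing

  allTr : List Tr
  allTr = mapMaybe toTr allKeys

  ind : Q → Q → ℕ
  ind p q = if does (p ≟Q q) then 1 else 0

  Pre : Q → Tr → ℕ
  Pre p ((a , q , s , q' , s') , _) = ind p q ℕ.+ ind p q'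

  Post : Q → Tr → ℕ
  Post p ((a , q , s , q' , s') , _) = ind p s ℕ.+ ind p s'

  𝒜 : Q → Tr → ℤ
  𝒜 p t = (+ Post p t) ℤ.- (+ Pre p t)

  Marking : Set
  Marking = Q → ℕ

  IsConfig : Marking → Set
  IsConfig C = sum (map (λ ℓ → C (inj₁ ℓ)) (allFin nL)) ≡ 1

  Fires : Marking → Tr → Marking → Set
  Fires M t M' = (∀ p → Pre p t ≤ M p) × (∀ p → + M' p ≡ (+ M p) ℤ.+ 𝒜 p t)

  data Run : Marking → List Tr → Marking → Set where
    done : ∀ {M} → Run M [] M
    step : ∀ {M M' M'' t ξ} → Fires M t M' → Run M' ξ M'' → Run M (t ∷ ξ) M''

  norm : (Tr → ℕ) → ℕ
  norm x = sum (map x allTr)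

  CplusAx : Marking → (Tr → ℕ) → Q → ℤ
  CplusAx C x p = foldr ℤ._+_ (+ C p) (map (λ t → (+ x t) ℤ.* 𝒜 p t) allTr)

  leaderEdge : Tr → Maybe (Fin nL × Fin nL)
  leaderEdge ((a , inj₁ q , inj₁ s , q' , s') , _) = just (q , s)
  leaderEdge ((a , q , s , inj₁ q' , inj₁ s') , _) = just (q' , s')
  leaderEdge _ = nothing

  data Reach (x : Tr → ℕ) (u : Fin nL) : Fin nL → Set where
    here : Reach x u u
    edge : ∀ {w v} (t : Tr) → 0 < x t → leaderEdge t ≡ just (w , v) →
           Reach x u w → Reach x u v

  -- lead(C) = ℓ  (for a configuration, the unique ℓ with C(ℓ) > 0)
  Lead : Marking → Fin nL → Set
  Lead C ℓ = 0 < C (inj₁ ℓ)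

  Compatible : Marking → (Tr → ℕ) → Set
  Compatible C x =
    (∀ p → 0ℤ ℤ.≤ CplusAx C x p) ×
    (∀ ℓ → Lead C ℓ → ∀ t f g → 0 < x t → leaderEdge t ≡ just (f , g) →
       Reach x ℓ f × Reach x ℓ g)

  count : Tr → List Tr → ℕ
  count t ξ = length (filter (λ u → key u ≟K key t) ξ)

  Parikh≡ : List Tr → (Tr → ℕ) → Set
  Parikh≡ ξ x = ∀ t → count t ξ ≡ x t

{-# OPTIONS --safe #-}
-- Let X be the list in which every transition t occurs x(t) times. Through leaderEdge, the leader
-- transitions in X are the edges of a multigraph on Q^L; the others are silent steps that leave the
-- leader where it is and can be placed anywhere. At a leader state p, (C + A x)(p) ≥ 0 says
-- out(p) ≤ in(p) + [p = lead(C)], and compatibility says that every edge starts at a vertex reachable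
-- from lead(C). As in Euler's theorem, X can then be ordered as a walk from lead(C): take a maximal
-- walk; what is left is closed (out ≤ in everywhere, with equal totals by the handshake lemma), and
-- while edges remain one of them leaves a visited vertex, so a closed walk through it can be spliced
-- in. Firing X in this order finds the single leader token exactly where each leader transition needs
-- it, and every step takes at most two tokens from each follower state, which C(q) ≥ 2‖x‖ pays for.
module Submission where

open import Defs
open import Data.Nat using (ℕ; zero; suc; _+_; _*_; _∸_; _≤_; _<_; _≥_; z≤n; s≤s)
open import Data.Nat.Properties
open import Data.Nat.Induction using (<-wellFounded)
open import Data.Nat.ListAction using (sum)
open import Data.Nat.ListAction.Properties using (sum-++; sum-↭)
open import Data.Bool using (T; true; false; _∧_; not; if_then_else_)
open import Data.Bool.Properties using (T?; T-∧; T-irrelevant)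
open import Data.Fin using (Fin; zero; suc)
import Data.Fin.Properties as FinP
open import Data.Integer as ℤ using (ℤ; 0ℤ)
import Data.Integer.Properties as ℤ
open import Data.Integer.Solver using (module +-*-Solver)
open import Data.Maybe using (Maybe; just; nothing)
import Data.Maybe.Properties as Maybe
open import Data.Sum using (_⊎_; inj₁; inj₂)
import Data.Sum.Properties as Sum
open import Data.Product using (Σ; ∃; ∃₂; _×_; _,_; proj₁; proj₂)
open import Data.List
  using (List; []; _∷_; [_]; _++_; map; foldr; concatMap; mapMaybe; filter; length; replicate;
         tabulate; allFin; cartesianProduct)
import Data.List.Properties as List
import Data.List.Relation.Unary.All as All
open import Data.List.Relation.Unary.Any as Any using (Any; here; there; any?)
open import Data.List.Relation.Unary.AllPairs using (_∷_)
open import Data.List.Relation.Unary.Unique.Propositional using (Unique)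
import Data.List.Relation.Unary.Unique.Propositional.Properties as Unique
open import Data.List.Membership.Propositional using (_∈_; find)
open import Data.List.Membership.Propositional.Properties
  using (∈-allFin; ∈-map⁺; ∈-map⁻; ∈-++⁺ˡ; ∈-++⁺ʳ; ∈-++⁻; ∈-∃++; ∈-cartesianProduct⁺)
open import Data.List.Relation.Binary.Permutation.Propositional
  using (_↭_; ↭-refl; ↭-sym; ↭-trans; ↭-reflexive; prep; module PermutationReasoning)
import Data.List.Relation.Binary.Permutation.Propositional.Properties as Perm
open import Function using (_∘_; _on_; id)
open import Function.Bundles using (Equivalence)
open import Induction.WellFounded using (WellFounded; Acc; acc)
import Relation.Binary.Construct.On as On
open import Relation.Binary.Definitions using (DecidableEquality)
open import Relation.Binary.PropositionalEquality
  using (_≡_; _≢_; refl; sym; trans; cong; cong₂; subst; subst₂; module ≡-Reasoning)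
open import Relation.Nullary using (Dec; yes; no; does; ¬_; contradiction)
open import Relation.Nullary.Decidable using (dec-true; dec-false)
open import Algebra.Properties.CommutativeSemigroup +-commutativeSemigroup using (x∙yz≈y∙xz)
open import Algebra.Properties.CommutativeMonoid.Sum +-0-commutativeMonoid
  using (sum-syntax; ∑-distrib-+; sum-cong-≗; sum-replicate-zero)

-- Finite sums over Fin n

δ : ∀ {n} → Fin n → Fin n → ℕ
δ i j = if does (i FinP.≟ j) then 1 else 0

δ-refl : ∀ {n} (i : Fin n) → δ i i ≡ 1
δ-refl i = cong (if_then 1 else 0) (dec-true (i FinP.≟ i) refl)

δ-≢ : ∀ {n} {i j : Fin n} → i ≢ j → δ i j ≡ 0
δ-≢ {i = i} {j} i≢j = cong (if_then 1 else 0) (dec-false (i FinP.≟ j) i≢j)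

sum-map-allFin : ∀ {n} (f : Fin n → ℕ) → sum (map f (allFin n)) ≡ ∑[ i < n ] f i
sum-map-allFin {zero} f = refl
sum-map-allFin {suc n} f = cong (f zero +_) (begin
  sum (map f (tabulate suc))     ≡⟨ cong sum (List.map-tabulate suc f) ⟩
  sum (tabulate (f ∘ suc))       ≡⟨ cong sum (List.map-tabulate id (f ∘ suc)) ⟨
  sum (map (f ∘ suc) (allFin n)) ≡⟨ sum-map-allFin (f ∘ suc) ⟩
  ∑[ i < n ] f (suc i)           ∎)
  where open ≡-Reasoning

∑-δ : ∀ {n} (i : Fin n) → ∑[ j < n ] δ j i ≡ 1
∑-δ {suc n} zero = cong suc (sum-replicate-zero n)
∑-δ {suc n} (suc i) = ∑-δ i

∑-mono-≤ : ∀ {n} {f g : Fin n → ℕ} → (∀ i → f i ≤ g i) → ∑[ i < n ] f i ≤ ∑[ i < n ] g i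
∑-mono-≤ {zero} f≤g = z≤n
∑-mono-≤ {suc n} f≤g = +-mono-≤ (f≤g zero) (∑-mono-≤ (f≤g ∘ suc))

+-≤-≡⇒≡ˡ : ∀ {a b c d} → a ≤ c → b ≤ d → a + b ≡ c + d → a ≡ c
+-≤-≡⇒≡ˡ {a} {b} {c} {d} a≤c b≤d eq = ≤-antisym a≤c (+-cancelʳ-≤ d c a (begin
  c + d ≡⟨ eq ⟨
  a + b ≤⟨ +-monoʳ-≤ a b≤d ⟩
  a + d ∎))
  where open ≤-Reasoning

∑-≡-≤⇒≗ : ∀ {n} {f g : Fin n → ℕ} → (∀ i → f i ≤ g i) →
          ∑[ i < n ] f i ≡ ∑[ i < n ] g i → ∀ i → f i ≡ g i
∑-≡-≤⇒≗ {suc n} {f} {g} f≤g eq zero = +-≤-≡⇒≡ˡ (f≤g zero) (∑-mono-≤ (f≤g ∘ suc)) eq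
∑-≡-≤⇒≗ {suc n} {f} {g} f≤g eq (suc i) = ∑-≡-≤⇒≗ (f≤g ∘ suc) tails≡ i
  where
  tails≡ : ∑[ j < n ] f (suc j) ≡ ∑[ j < n ] g (suc j)
  tails≡ = +-cancelˡ-≡ (f zero) _ _ (trans eq (cong (_+ _) (sym (∑-≡-≤⇒≗ f≤g eq zero))))

∑≡1⇒indicator : ∀ {n} (f : Fin n → ℕ) → ∑[ i < n ] f i ≡ 1 → ∃ λ i → ∀ j → f j ≡ δ j i
∑≡1⇒indicator {suc n} f eq with f zero in f₀≡
... | 0 with ∑≡1⇒indicator (f ∘ suc) eq
...   | i , f≗δ = suc i , λ { zero → f₀≡ ; (suc j) → f≗δ j }
∑≡1⇒indicator {suc n} f eq | 1 = zero , λ { zero → f₀≡ ; (suc j) → sym (tail≡0 j) }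
  where
  tail≡0 : ∀ j → 0 ≡ f (suc j)
  tail≡0 = ∑-≡-≤⇒≗ (λ _ → z≤n) (trans (sum-replicate-zero n) (sym (suc-injective eq)))
∑≡1⇒indicator {suc n} f () | suc (suc _)

-- Multiplicities in lists

module _ {a} {A : Set a} (_≟_ : DecidableEquality A) where

  occurrences : A → List A → ℕ
  occurrences y xs = length (filter (_≟ y) xs)

  occurrences-unique : ∀ {y xs} → Unique xs → y ∈ xs → occurrences y xs ≡ 1
  occurrences-unique {y} {y ∷ xs} (y∉xs ∷ _) (here refl) = begin
    length (filter (_≟ y) (y ∷ xs))
      ≡⟨ cong length (List.filter-accept (_≟ y) refl) ⟩
    suc (length (filter (_≟ y) xs))
      ≡⟨ cong (suc ∘ length) (List.filter-none (_≟ y) (All.map (_∘ sym) y∉xs)) ⟩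
    1 ∎
    where open ≡-Reasoning
  occurrences-unique {y} {x ∷ xs} (x∉xs ∷ xs-unique) (there y∈xs) = begin
    length (filter (_≟ y) (x ∷ xs))
      ≡⟨ cong length (List.filter-reject (_≟ y) (All.lookup x∉xs y∈xs)) ⟩
    length (filter (_≟ y) xs)
      ≡⟨ occurrences-unique xs-unique y∈xs ⟩
    1 ∎
    where open ≡-Reasoning

concatMap-map≡map-cartesianProduct : ∀ {a b c} {A : Set a} {B : Set b} {C : Set c}
  (g : A × B → C) xs ys →
  concatMap (λ x → map (λ y → g (x , y)) ys) xs ≡ map g (cartesianProduct xs ys)
concatMap-map≡map-cartesianProduct g [] ys = refl
concatMap-map≡map-cartesianProduct g (x ∷ xs) ys = begin
  map (g ∘ (x ,_)) ys ++ concatMap (λ x → map (λ y → g (x , y)) ys) xs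
    ≡⟨ cong₂ _++_ (List.map-∘ ys) (concatMap-map≡map-cartesianProduct g xs ys) ⟩
  map g (map (x ,_) ys) ++ map g (cartesianProduct xs ys)
    ≡⟨ List.map-++ g (map (x ,_) ys) (cartesianProduct xs ys) ⟨
  map g (cartesianProduct (x ∷ xs) ys) ∎
  where open ≡-Reasoning

module _ {a} {A : Set a} where

  expand : (A → ℕ) → List A → List A
  expand x = concatMap (λ u → replicate (x u) u)

  weighted : (A → ℕ) → (A → ℕ) → List A → ℕ
  weighted x f L = sum (map (λ u → x u * f u) L)

  sum-map-replicate : ∀ (f : A → ℕ) n u → sum (map f (replicate n u)) ≡ n * f u
  sum-map-replicate f zero u = refl
  sum-map-replicate f (suc n) u = cong (f u +_) (sum-map-replicate f n u)

  sum-map-expand : ∀ (f : A → ℕ) x L → sum (map f (expand x L)) ≡ weighted x f L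
  sum-map-expand f x [] = refl
  sum-map-expand f x (u ∷ L) = begin
    sum (map f (replicate (x u) u ++ expand x L))
      ≡⟨ cong sum (List.map-++ f (replicate (x u) u) (expand x L)) ⟩
    sum (map f (replicate (x u) u) ++ map f (expand x L))
      ≡⟨ sum-++ (map f (replicate (x u) u)) _ ⟩
    sum (map f (replicate (x u) u)) + sum (map f (expand x L))
      ≡⟨ cong₂ _+_ (sum-map-replicate f (x u) u) (sum-map-expand f x L) ⟩
    x u * f u + weighted x f L ∎
    where open ≡-Reasoning

  length-expand : ∀ x L → length (expand x L) ≡ sum (map x L)
  length-expand x [] = refl
  length-expand x (u ∷ L) = begin
    length (replicate (x u) u ++ expand x L)
      ≡⟨ List.length-++ (replicate (x u) u) ⟩
    length (replicate (x u) u) + length (expand x L)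
      ≡⟨ cong₂ _+_ (List.length-replicate (x u)) (length-expand x L) ⟩
    x u + sum (map x L) ∎
    where open ≡-Reasoning

-- ℤ's +_ is opened only here: elsewhere it would clash with sections of ℕ's _+_.
module _ where
  open import Data.Integer using (+_)

  +[m∸n+o]≡m+[o-n] : ∀ {m n} o → n ≤ m → + (m ∸ n + o) ≡ + m ℤ.+ (+ o ℤ.- + n)
  +[m∸n+o]≡m+[o-n] {m} {n} o n≤m = begin
    + (m ∸ n + o)             ≡⟨ ℤ.pos-+ (m ∸ n) o ⟩
    + (m ∸ n) ℤ.+ + o         ≡⟨ cong (ℤ._+ + o) (trans (ℤ.m-n≡m⊖n m n) (ℤ.⊖-≥ n≤m)) ⟨
    (+ m ℤ.- + n) ℤ.+ + o     ≡⟨ ℤ.+-assoc (+ m) (ℤ.- + n) (+ o) ⟩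
    + m ℤ.+ (ℤ.- + n ℤ.+ + o) ≡⟨ cong (ℤ._+_ (+ m)) (ℤ.+-comm (ℤ.- + n) (+ o)) ⟩
    + m ℤ.+ (+ o ℤ.- + n)     ∎
    where open ≡-Reasoning

  foldr-weighted-difference : ∀ {A : Set} (x f g : A → ℕ) c L →
    foldr ℤ._+_ (+ c) (map (λ t → + x t ℤ.* (+ g t ℤ.- + f t)) L)
      ≡ + (c + weighted x g L) ℤ.- + weighted x f L
  foldr-weighted-difference x f g c [] = sym (trans (ℤ.+-identityʳ _) (cong +_ (+-identityʳ c)))
  foldr-weighted-difference x f g c (u ∷ L) = begin
    a′ ℤ.* (gᵤ′ ℤ.- fᵤ′) ℤ.+ foldr ℤ._+_ c′ (map (λ t → + x t ℤ.* (+ g t ℤ.- + f t)) L)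
      ≡⟨ cong (ℤ._+_ (a′ ℤ.* (gᵤ′ ℤ.- fᵤ′))) (foldr-weighted-difference x f g c L) ⟩
    a′ ℤ.* (gᵤ′ ℤ.- fᵤ′) ℤ.+ (+ (c + G) ℤ.- F′)
      ≡⟨ cong (λ z → a′ ℤ.* (gᵤ′ ℤ.- fᵤ′) ℤ.+ (z ℤ.- F′)) (ℤ.pos-+ c G) ⟩
    a′ ℤ.* (gᵤ′ ℤ.- fᵤ′) ℤ.+ ((c′ ℤ.+ G′) ℤ.- F′)
      ≡⟨ solve 6 (λ a gᵤ fᵤ c G F → a :* (gᵤ :- fᵤ) :+ ((c :+ G) :- F)
                                   := (c :+ (a :* gᵤ :+ G)) :- (a :* fᵤ :+ F))
               refl a′ gᵤ′ fᵤ′ c′ G′ F′ ⟩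
    (c′ ℤ.+ (a′ ℤ.* gᵤ′ ℤ.+ G′)) ℤ.- (a′ ℤ.* fᵤ′ ℤ.+ F′)
      ≡⟨ cong₂ (λ y z → (c′ ℤ.+ (y ℤ.+ G′)) ℤ.- (z ℤ.+ F′)) (ℤ.pos-* a gᵤ) (ℤ.pos-* a fᵤ) ⟨
    (c′ ℤ.+ (+ (a * gᵤ) ℤ.+ G′)) ℤ.- (+ (a * fᵤ) ℤ.+ F′)
      ≡⟨ cong₂ (λ y z → (c′ ℤ.+ y) ℤ.- z) (ℤ.pos-+ (a * gᵤ) G) (ℤ.pos-+ (a * fᵤ) F) ⟨
    (c′ ℤ.+ + (a * gᵤ + G)) ℤ.- + (a * fᵤ + F)
      ≡⟨ cong (ℤ._- + (a * fᵤ + F)) (ℤ.pos-+ c (a * gᵤ + G)) ⟨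
    + (c + (a * gᵤ + G)) ℤ.- + (a * fᵤ + F) ∎
    where
    open ≡-Reasoning
    open +-*-Solver
    a = x u
    gᵤ = g u
    fᵤ = f u
    G = weighted x g L
    F = weighted x f L
    a′ gᵤ′ fᵤ′ c′ G′ F′ : ℤ
    a′ = + a
    gᵤ′ = + gᵤ
    fᵤ′ = + fᵤ
    c′ = + c
    G′ = + G
    F′ = + F

-- Eulerian walks with silent steps

-- An element t with edge t ≡ nothing is silent: a walk crosses it without moving.
module Walks {A : Set} {n : ℕ} (edge : A → Maybe (Fin n × Fin n)) where

  δsrc δtgt : Fin n → Maybe (Fin n × Fin n) → ℕ
  δsrc p (just (u , _)) = δ p u
  δsrc p nothing        = 0
  δtgt p (just (_ , v)) = δ p v
  δtgt p nothing        = 0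

  degree : (Maybe (Fin n × Fin n) → ℕ) → List A → ℕ
  degree w ts = sum (map (w ∘ edge) ts)

  outDeg inDeg : List A → Fin n → ℕ
  outDeg ts p = degree (δsrc p) ts
  inDeg  ts p = degree (δtgt p) ts

  degree-++ : ∀ w xs ys → degree w (xs ++ ys) ≡ degree w xs + degree w ys
  degree-++ w xs ys = trans (cong sum (List.map-++ (w ∘ edge) xs ys)) (sum-++ (map (w ∘ edge) xs) _)

  degree-↭ : ∀ w {xs ys} → xs ↭ ys → degree w xs ≡ degree w ys
  degree-↭ w = sum-↭ ∘ Perm.map⁺ (w ∘ edge)

  data Step (u : Fin n) (t : A) : Fin n → Set where
    move : ∀ {v} → edge t ≡ just (u , v) → Step u t v
    stay : edge t ≡ nothing → Step u t u

  infixr 5 _∷_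
  data Walk : Fin n → List A → Fin n → Set where
    []  : ∀ {u} → Walk u [] u
    _∷_ : ∀ {u t v ts w} → Step u t v → Walk v ts w → Walk u (t ∷ ts) w

  walk-++ : ∀ {u v w xs ys} → Walk u xs v → Walk v ys w → Walk u (xs ++ ys) w
  walk-++ []      ys = ys
  walk-++ (s ∷ xs) ys = s ∷ walk-++ xs ys

  step-flow : ∀ {u t v} → Step u t v → ∀ p → δsrc p (edge t) + δ p v ≡ δtgt p (edge t) + δ p u
  step-flow (move {v} e) p rewrite e = +-comm (δ p _) (δ p v)
  step-flow (stay e)     p rewrite e = refl

  walk-flow : ∀ {u ts v} → Walk u ts v → ∀ p → outDeg ts p + δ p v ≡ inDeg ts p + δ p u
  walk-flow [] p = refl
  walk-flow {u} {t ∷ ts} {w} (_∷_ {v = v} s walk) p = begin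
    (a + outDeg ts p) + δ p w ≡⟨ +-assoc a _ _ ⟩
    a + (outDeg ts p + δ p w) ≡⟨ cong (a +_) (walk-flow walk p) ⟩
    a + (inDeg ts p + δ p v)  ≡⟨ x∙yz≈y∙xz a (inDeg ts p) (δ p v) ⟩
    inDeg ts p + (a + δ p v)  ≡⟨ cong (inDeg ts p +_) (step-flow s p) ⟩
    inDeg ts p + (b + δ p u)  ≡⟨ x∙yz≈y∙xz (inDeg ts p) b (δ p u) ⟩
    b + (inDeg ts p + δ p u)  ≡⟨ +-assoc b _ _ ⟨
    (b + inDeg ts p) + δ p u  ∎
    where
    open ≡-Reasoning
    a = δsrc p (edge t)
    b = δtgt p (edge t)

  Closed : List A → Set
  Closed ts = ∀ p → outDeg ts p ≡ inDeg ts p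

  cycle-closed : ∀ {u ts} → Walk u ts u → Closed ts
  cycle-closed {u} walk p = +-cancelʳ-≡ (δ p u) _ _ (walk-flow walk p)

  closed-↭ : ∀ {xs ys} → xs ↭ ys → Closed xs → Closed ys
  closed-↭ xs↭ys closed p =
    trans (sym (degree-↭ (δsrc p) xs↭ys)) (trans (closed p) (degree-↭ (δtgt p) xs↭ys))

  closed-++⁻ʳ : ∀ xs {ys} → Closed xs → Closed (xs ++ ys) → Closed ys
  closed-++⁻ʳ xs {ys} closed-xs closed-xsys p = +-cancelˡ-≡ (outDeg xs p) _ _ (begin
    outDeg xs p + outDeg ys p ≡⟨ degree-++ (δsrc p) xs ys ⟨
    outDeg (xs ++ ys) p       ≡⟨ closed-xsys p ⟩
    inDeg (xs ++ ys) p        ≡⟨ degree-++ (δtgt p) xs ys ⟩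
    inDeg xs p + inDeg ys p   ≡⟨ cong (_+ inDeg ys p) (closed-xs p) ⟨
    outDeg xs p + inDeg ys p  ∎)
    where open ≡-Reasoning

  stuck-walk-returns : ∀ {u C v Z} → Walk u C v → outDeg Z v ≡ 0 → Closed (C ++ Z) → v ≡ u
  stuck-walk-returns {u} {C} {v} {Z} walk stuck closed with v FinP.≟ u
  ... | yes v≡u = v≡u
  ... | no v≢u = contradiction in-C<in-C (<-irrefl refl)
    where
    open ≤-Reasoning
    in-C<in-C : inDeg C v < inDeg C v
    in-C<in-C = begin-strict
      inDeg C v                  ≤⟨ m≤m+n (inDeg C v) (inDeg Z v) ⟩
      inDeg C v + inDeg Z v      ≡⟨ degree-++ (δtgt v) C Z ⟨
      inDeg (C ++ Z) v           ≡⟨ closed v ⟨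
      outDeg (C ++ Z) v          ≡⟨ degree-++ (δsrc v) C Z ⟩
      outDeg C v + outDeg Z v    ≡⟨ cong (outDeg C v +_) stuck ⟩
      outDeg C v + 0             <⟨ +-monoʳ-< (outDeg C v) (s≤s z≤n) ⟩
      outDeg C v + 1             ≡⟨ cong (outDeg C v +_) (δ-refl v) ⟨
      outDeg C v + δ v v         ≡⟨ walk-flow walk v ⟩
      inDeg C v + δ v u          ≡⟨ cong (inDeg C v +_) (δ-≢ v≢u) ⟩
      inDeg C v + 0              ≡⟨ +-identityʳ (inDeg C v) ⟩
      inDeg C v                  ∎

  ∑-δsrc≡∑-δtgt : ∀ m → ∑[ p < n ] δsrc p m ≡ ∑[ p < n ] δtgt p m
  ∑-δsrc≡∑-δtgt (just (u , v)) = trans (∑-δ u) (sym (∑-δ v))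
  ∑-δsrc≡∑-δtgt nothing        = refl

  handshake : ∀ ts → ∑[ p < n ] outDeg ts p ≡ ∑[ p < n ] inDeg ts p
  handshake []       = refl
  handshake (t ∷ ts) = begin
    ∑[ p < n ] (δsrc p (edge t) + outDeg ts p)
      ≡⟨ ∑-distrib-+ (λ p → δsrc p (edge t)) (outDeg ts) ⟩
    ∑[ p < n ] δsrc p (edge t) + ∑[ p < n ] outDeg ts p
      ≡⟨ cong₂ _+_ (∑-δsrc≡∑-δtgt (edge t)) (handshake ts) ⟩
    ∑[ p < n ] δtgt p (edge t) + ∑[ p < n ] inDeg ts p
      ≡⟨ ∑-distrib-+ (λ p → δtgt p (edge t)) (inDeg ts) ⟨
    ∑[ p < n ] (δtgt p (edge t) + inDeg ts p) ∎
    where open ≡-Reasoning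

  LeavesFrom : Fin n → A → Set
  LeavesFrom u t = ∃ λ v → edge t ≡ just (u , v)

  leavesFrom? : ∀ u t → Dec (LeavesFrom u t)
  leavesFrom? u t with edge t
  ... | nothing = no λ ()
  ... | just (w , v) with w FinP.≟ u
  ...   | yes refl = yes (v , refl)
  ...   | no w≢u   = no λ (_ , e) → w≢u (cong proj₁ (Maybe.just-injective e))

  δsrc-¬leaves : ∀ u t → ¬ LeavesFrom u t → δsrc u (edge t) ≡ 0
  δsrc-¬leaves u t ¬leaves with edge t
  ... | nothing      = refl
  ... | just (w , v) = δ-≢ λ u≡w → ¬leaves (v , cong (λ w → just (w , v)) (sym u≡w))

  outDeg-none : ∀ u ts → ¬ Any (LeavesFrom u) ts → outDeg ts u ≡ 0
  outDeg-none u []       _    = refl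
  outDeg-none u (t ∷ ts) none =
    cong₂ _+_ (δsrc-¬leaves u t (none ∘ here)) (outDeg-none u ts (none ∘ there))

  Shorter : List A → List A → Set
  Shorter = _<_ on length

  shorter-wf : WellFounded Shorter
  shorter-wf = On.wellFounded length <-wellFounded

  removal-shorter : ∀ xs t ys → Shorter (xs ++ ys) (xs ++ t ∷ ys)
  removal-shorter xs t ys = ≤-reflexive (sym (List.length-++-sucʳ xs t ys))

  MaximalWalk : List A → Fin n → Set
  MaximalWalk E u = ∃₂ λ W Z → ∃ λ v → Walk u W v × E ↭ W ++ Z × outDeg Z v ≡ 0

  maximal-walk : ∀ E u → MaximalWalk E u
  maximal-walk E u = go E u (shorter-wf E)
    where
    go : ∀ E u → Acc Shorter E → MaximalWalk E u
    go E u (acc rec) with any? (leavesFrom? u) E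
    ... | no none = [] , E , u , [] , ↭-refl , outDeg-none u E none
    ... | yes some with find some
    ...   | t , t∈E , v , e with ∈-∃++ t∈E
    ...     | xs , ys , refl with go (xs ++ ys) v (rec (removal-shorter xs t ys))
    ...       | W , Z , w , walk , xsys↭ , stuck =
      t ∷ W , Z , w , move e ∷ walk , ↭-trans (Perm.shift t xs ys) (prep t xsys↭) , stuck

  cycle-through : ∀ {Z t u v} → Closed Z → t ∈ Z → edge t ≡ just (u , v) →
    ∃₂ λ C Z′ → Walk u C u × Z ↭ C ++ Z′ × Closed Z′ × Shorter Z′ Z
  cycle-through {t = t} {u} {v} closed t∈Z e with ∈-∃++ t∈Z
  ... | xs , ys , refl with maximal-walk (xs ++ ys) v
  ...   | W , Z′ , w , walk , xsys↭ , stuck = t ∷ W , Z′ , cycle , Z↭ , closed-Z′ , shorter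
    where
    Z↭ : xs ++ t ∷ ys ↭ (t ∷ W) ++ Z′
    Z↭ = ↭-trans (Perm.shift t xs ys) (prep t xsys↭)
    cycle : Walk u (t ∷ W) u
    cycle = subst (Walk u (t ∷ W))
                  (stuck-walk-returns (move e ∷ walk) stuck (closed-↭ Z↭ closed)) (move e ∷ walk)
    closed-Z′ : Closed Z′
    closed-Z′ = closed-++⁻ʳ (t ∷ W) (cycle-closed cycle) (closed-↭ Z↭ closed)
    shorter : Shorter Z′ (xs ++ t ∷ ys)
    shorter = begin-strict
      length Z′                  <⟨ s≤s (m≤n+m (length Z′) (length W)) ⟩
      suc (length W + length Z′) ≡⟨ List.length-++ (t ∷ W) ⟨
      length ((t ∷ W) ++ Z′)     ≡⟨ Perm.↭-length Z↭ ⟨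
      length (xs ++ t ∷ ys)      ∎
      where open ≤-Reasoning

  data Reaches (E : List A) (u : Fin n) : Fin n → Set where
    here : Reaches E u u
    via  : ∀ {t v w} → t ∈ E → edge t ≡ just (v , w) → Reaches E u v → Reaches E u w

  SourcesReachable : List A → Fin n → Set
  SourcesReachable E u = ∀ {t v w} → t ∈ E → edge t ≡ just (v , w) → Reaches E u v

  Visits : Fin n → List A → Fin n → Fin n → Set
  Visits u W w v = ∃₂ λ W₁ W₂ → W ≡ W₁ ++ W₂ × Walk u W₁ v × Walk v W₂ w

  visits-target : ∀ {u W w t v′ v} → Walk u W w → t ∈ W → edge t ≡ just (v′ , v) → Visits u W w v
  visits-target {W = t ∷ W} (move e′ ∷ walk) (here refl) e with trans (sym e′) e
  ... | refl = [ t ] , W , refl , move e′ ∷ [] , walk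
  visits-target (stay e′ ∷ walk) (here refl) e with trans (sym e′) e
  ... | ()
  visits-target {W = t ∷ _} (s ∷ walk) (there t∈W) e with visits-target walk t∈W e
  ... | W₁ , W₂ , refl , walk₁ , walk₂ = t ∷ W₁ , W₂ , refl , s ∷ walk₁ , walk₂

  Exit : Fin n → List A → Fin n → List A → Set
  Exit u W w Z = ∃ λ t → t ∈ Z × ∃₂ λ v v′ → edge t ≡ just (v , v′) × Visits u W w v

  visits-or-exit : ∀ {E u W w Z v} → Walk u W w → E ↭ W ++ Z → Reaches E u v →
                   Visits u W w v ⊎ Exit u W w Z
  visits-or-exit walk _ here = inj₁ ([] , _ , refl , [] , walk)
  visits-or-exit {W = W} walk E↭ (via {t} t∈E e reach) with visits-or-exit walk E↭ reach
  ... | inj₂ exit = inj₂ exit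
  ... | inj₁ visits with ∈-++⁻ W (Perm.∈-resp-↭ E↭ t∈E)
  ...   | inj₁ t∈W = inj₁ (visits-target walk t∈W e)
  ...   | inj₂ t∈Z = inj₂ (t , t∈Z , _ , _ , e , visits)

  exit : ∀ {E u W w Z t v v′} → SourcesReachable E u → Walk u W w → E ↭ W ++ Z →
         t ∈ Z → edge t ≡ just (v , v′) → Exit u W w Z
  exit {W = W} {t = t} {v} {v′} reach walk E↭ t∈Z e
    with visits-or-exit walk E↭ (reach (Perm.∈-resp-↭ (↭-sym E↭) (∈-++⁺ʳ W t∈Z)) e)
  ... | inj₁ visits = t , t∈Z , v , v′ , e , visits
  ... | inj₂ exit   = exit

  splice-↭ : ∀ {E : List A} W₁ W₂ {Z} C {Z′} → E ↭ (W₁ ++ W₂) ++ Z → Z ↭ C ++ Z′ →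
             E ↭ (W₁ ++ C ++ W₂) ++ Z′
  splice-↭ {E} W₁ W₂ {Z} C {Z′} E↭ Z↭ = begin
    E                      ↭⟨ E↭ ⟩
    (W₁ ++ W₂) ++ Z        ↭⟨ Perm.++⁺ˡ (W₁ ++ W₂) Z↭ ⟩
    (W₁ ++ W₂) ++ C ++ Z′  ≡⟨ List.++-assoc W₁ W₂ (C ++ Z′) ⟩
    W₁ ++ W₂ ++ C ++ Z′    ↭⟨ Perm.++⁺ˡ W₁ (Perm.shifts W₂ C) ⟩
    W₁ ++ C ++ W₂ ++ Z′    ≡⟨ cong (W₁ ++_) (List.++-assoc C W₂ Z′) ⟨
    W₁ ++ (C ++ W₂) ++ Z′  ≡⟨ List.++-assoc W₁ (C ++ W₂) Z′ ⟨
    (W₁ ++ C ++ W₂) ++ Z′  ∎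
    where open PermutationReasoning

  silent-or-edge : ∀ t → edge t ≡ nothing ⊎ ∃₂ λ v v′ → edge t ≡ just (v , v′)
  silent-or-edge t with edge t
  ... | nothing       = inj₁ refl
  ... | just (v , v′) = inj₂ (v , v′ , refl)

  closed-silent-∷⁻ : ∀ {t Z} → edge t ≡ nothing → Closed (t ∷ Z) → Closed Z
  closed-silent-∷⁻ {t} {Z} e closed p =
    subst (λ m → δsrc p m + outDeg Z p ≡ δtgt p m + inDeg Z p) e (closed p)

  -- Hierholzer's splicing: Z shrinks by a closed walk through a vertex the walk already visits.
  absorb : ∀ {E ℓ W e Z} → SourcesReachable E ℓ → Walk ℓ W e → E ↭ W ++ Z → Closed Z →
           Acc Shorter Z → ∃ λ W′ → Walk ℓ W′ e × E ↭ W′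
  absorb {W = W} {Z = []} _ walk E↭ _ _ = W , walk , ↭-trans E↭ (↭-reflexive (List.++-identityʳ W))
  absorb {W = W} {Z = t ∷ Z} reach walk E↭ closed (acc rec) with silent-or-edge t
  ... | inj₁ e = absorb {Z = Z} reach (stay e ∷ walk) (↭-trans E↭ (Perm.shift t W Z))
                  (closed-silent-∷⁻ {t} {Z} e closed) (rec ≤-refl)
  ... | inj₂ (_ , _ , e) with exit reach walk E↭ (here refl) e
  ...   | _ , t′∈Z , _ , _ , e′ , W₁ , W₂ , refl , walk₁ , walk₂ with cycle-through closed t′∈Z e′
  ...     | C , Z′ , cycle , Z↭ , closed-Z′ , shorter =
    absorb {Z = Z′} reach (walk-++ walk₁ (walk-++ cycle walk₂)) (splice-↭ W₁ W₂ C E↭ Z↭)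
           closed-Z′ (rec shorter)

  Balanced : List A → Fin n → Set
  Balanced E ℓ = ∀ p → outDeg E p ≤ δ p ℓ + inDeg E p

  remainder-closed : ∀ {E ℓ W e Z} → Balanced E ℓ → Walk ℓ W e → E ↭ W ++ Z →
                     outDeg Z e ≡ 0 → Closed Z
  remainder-closed {E} {ℓ} {W} {e} {Z} balanced walk E↭ stuck = ∑-≡-≤⇒≗ out≤in (handshake Z)
    where
    out≤in : ∀ p → outDeg Z p ≤ inDeg Z p
    out≤in p with p FinP.≟ e
    ... | yes refl = subst (_≤ inDeg Z p) (sym stuck) z≤n
    ... | no p≢e = +-cancelˡ-≤ (δ p ℓ + inDeg W p) _ _ (begin
      δ p ℓ + inDeg W p + outDeg Z p   ≡⟨ cong (_+ outDeg Z p) out-W ⟨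
      outDeg W p + outDeg Z p          ≡⟨ degree-++ (δsrc p) W Z ⟨
      outDeg (W ++ Z) p                ≡⟨ degree-↭ (δsrc p) E↭ ⟨
      outDeg E p                       ≤⟨ balanced p ⟩
      δ p ℓ + inDeg E p                ≡⟨ cong (δ p ℓ +_) (degree-↭ (δtgt p) E↭) ⟩
      δ p ℓ + inDeg (W ++ Z) p         ≡⟨ cong (δ p ℓ +_) (degree-++ (δtgt p) W Z) ⟩
      δ p ℓ + (inDeg W p + inDeg Z p)  ≡⟨ +-assoc (δ p ℓ) _ _ ⟨
      δ p ℓ + inDeg W p + inDeg Z p    ∎)
      where
      open ≤-Reasoning
      out-W : outDeg W p ≡ δ p ℓ + inDeg W p
      out-W = begin-equality
        outDeg W p              ≡⟨ +-identityʳ (outDeg W p) ⟨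
        outDeg W p + 0          ≡⟨ cong (outDeg W p +_) (δ-≢ p≢e) ⟨
        outDeg W p + δ p e      ≡⟨ walk-flow walk p ⟩
        inDeg W p + δ p ℓ       ≡⟨ +-comm (inDeg W p) (δ p ℓ) ⟩
        δ p ℓ + inDeg W p       ∎

  eulerian-walk : ∀ {E ℓ} → Balanced E ℓ → SourcesReachable E ℓ → ∃₂ λ W e → Walk ℓ W e × E ↭ W
  eulerian-walk {E} {ℓ} balanced reach with maximal-walk E ℓ
  ... | W , Z , e , walk , E↭ , stuck
    with absorb reach walk E↭ (remainder-closed balanced walk E↭ stuck) (shorter-wf Z)
  ...   | W′ , walk′ , E↭W′ = W′ , e , walk′ , E↭W′

-- The net of a leader protocol

module _ (𝒫 : LeaderProtocol) where
  open LeaderProtocol 𝒫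
  open Walks (leaderEdge 𝒫)

  key-injective : ∀ {u t : Tr 𝒫} → key 𝒫 u ≡ key 𝒫 t → u ≡ t
  key-injective {κ , p} {.κ , q} refl = cong (κ ,_) (T-irrelevant p q)

  count-pos⇒∈ : ∀ {t xs} → 0 < count 𝒫 t xs → t ∈ xs
  count-pos⇒∈ {t} {u ∷ xs} pos with _≟K_ 𝒫 (key 𝒫 u) (key 𝒫 t)
  ... | yes eq = here (sym (key-injective eq))
  ... | no _  = there (count-pos⇒∈ pos)

  count-mapMaybe-toTr : ∀ t K → count 𝒫 t (mapMaybe (toTr 𝒫) K) ≡ occurrences (_≟K_ 𝒫) (key 𝒫 t) K
  count-mapMaybe-toTr t [] = refl
  count-mapMaybe-toTr t (κ ∷ K) with T? (valid 𝒫 κ)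
  ... | yes p with _≟K_ 𝒫 κ (key 𝒫 t)
  ...   | yes _ = cong suc (count-mapMaybe-toTr t K)
  ...   | no _ = count-mapMaybe-toTr t K
  count-mapMaybe-toTr t (κ ∷ K) | no ¬p with _≟K_ 𝒫 κ (key 𝒫 t)
  ...   | yes refl = contradiction (proj₂ t) ¬p
  ...   | no _ = count-mapMaybe-toTr t K

  allQ-unique : Unique (allQ 𝒫)
  allQ-unique = Unique.++⁺ (Unique.map⁺ Sum.inj₁-injective (Unique.allFin⁺ nL))
                           (Unique.map⁺ Sum.inj₂-injective (Unique.allFin⁺ nF))
                           inj₁≢inj₂
    where
    inj₁≢inj₂ : ∀ {q} → ¬ (q ∈ map inj₁ (allFin nL) × q ∈ map inj₂ (allFin nF))
    inj₁≢inj₂ (q∈₁ , q∈₂) with ∈-map⁻ inj₁ q∈₁ | ∈-map⁻ inj₂ q∈₂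
    ... | _ , _ , refl | _ , _ , ()

  ∈-allQ : ∀ q → q ∈ allQ 𝒫
  ∈-allQ (inj₁ ℓ) = ∈-++⁺ˡ (∈-map⁺ inj₁ (∈-allFin ℓ))
  ∈-allQ (inj₂ f) = ∈-++⁺ʳ (map inj₁ (allFin nL)) (∈-map⁺ inj₂ (∈-allFin f))

  Q⁴ : List (Q 𝒫 × Q 𝒫 × Q 𝒫 × Q 𝒫)
  Q⁴ = cartesianProduct (allQ 𝒫) (cartesianProduct (allQ 𝒫) (cartesianProduct (allQ 𝒫) (allQ 𝒫)))

  allKeys≡cartesianProduct : allKeys 𝒫 ≡ cartesianProduct (allFin k) Q⁴
  allKeys≡cartesianProduct = begin
    allKeys 𝒫
      ≡⟨ List.concatMap-cong (λ a → List.concatMap-cong (λ q → List.concatMap-cong (λ s →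
           concatMap-map≡map-cartesianProduct (λ r → a , q , s , r) Qs Qs) Qs) Qs) (allFin k) ⟩
    concatMap (λ a → concatMap (λ q → concatMap (λ s → map (λ r → a , q , s , r) Q²) Qs) Qs) (allFin k)
      ≡⟨ List.concatMap-cong (λ a → List.concatMap-cong (λ q →
           concatMap-map≡map-cartesianProduct (λ r → a , q , r) Qs Q²) Qs) (allFin k) ⟩
    concatMap (λ a → concatMap (λ q → map (λ r → a , q , r) Q³) Qs) (allFin k)
      ≡⟨ List.concatMap-cong (λ a → concatMap-map≡map-cartesianProduct (λ r → a , r) Qs Q³) (allFin k) ⟩
    concatMap (λ a → map (a ,_) Q⁴) (allFin k)
      ≡⟨ concatMap-map≡map-cartesianProduct (λ r → r) (allFin k) Q⁴ ⟩
    map (λ r → r) (cartesianProduct (allFin k) Q⁴)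
      ≡⟨ List.map-id _ ⟩
    cartesianProduct (allFin k) Q⁴ ∎
    where
    open ≡-Reasoning
    Qs = allQ 𝒫
    Q² = cartesianProduct Qs Qs
    Q³ = cartesianProduct Qs Q²

  occurrences-allKeys : ∀ κ → occurrences (_≟K_ 𝒫) κ (allKeys 𝒫) ≡ 1
  occurrences-allKeys (a , q , s , q′ , s′) rewrite allKeys≡cartesianProduct =
    occurrences-unique (_≟K_ 𝒫)
      (Unique.cartesianProduct⁺ (Unique.allFin⁺ k) (Unique.cartesianProduct⁺ allQ-unique
        (Unique.cartesianProduct⁺ allQ-unique (Unique.cartesianProduct⁺ allQ-unique allQ-unique))))
      (∈-cartesianProduct⁺ (∈-allFin a) (∈-cartesianProduct⁺ (∈-allQ q)
        (∈-cartesianProduct⁺ (∈-allQ s) (∈-cartesianProduct⁺ (∈-allQ q′) (∈-allQ s′)))))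

  count-allTr : ∀ t → count 𝒫 t (allTr 𝒫) ≡ 1
  count-allTr t = trans (count-mapMaybe-toTr t (allKeys 𝒫)) (occurrences-allKeys (key 𝒫 t))

  count-++ : ∀ t xs ys → count 𝒫 t (xs ++ ys) ≡ count 𝒫 t xs + count 𝒫 t ys
  count-++ t xs ys = trans (cong length (List.filter-++ _ xs ys)) (List.length-++ (filter _ xs))

  count-↭ : ∀ t {xs ys} → xs ↭ ys → count 𝒫 t xs ≡ count 𝒫 t ys
  count-↭ t = Perm.↭-length ∘ Perm.filter-↭ _

  ∈⇒count-pos : ∀ {t xs} → t ∈ xs → 0 < count 𝒫 t xs
  ∈⇒count-pos = List.filter-some _ ∘ Any.map (cong (key 𝒫) ∘ sym)

  count-replicate : ∀ t n u → count 𝒫 t (replicate n u) ≡ n * count 𝒫 t [ u ]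
  count-replicate t zero u = refl
  count-replicate t (suc n) u =
    trans (count-++ t [ u ] (replicate n u)) (cong (count 𝒫 t [ u ] +_) (count-replicate t n u))

  count-singleton-weight : ∀ (x : Tr 𝒫 → ℕ) t u → x u * count 𝒫 t [ u ] ≡ count 𝒫 t [ u ] * x t
  count-singleton-weight x t u with _≟K_ 𝒫 (key 𝒫 u) (key 𝒫 t)
  ... | yes eq with refl ← key-injective {u} {t} eq = *-comm (x t) 1
  ... | no _ = *-zeroʳ (x u)

  count-expand : ∀ (x : Tr 𝒫 → ℕ) t L → count 𝒫 t (expand x L) ≡ count 𝒫 t L * x t
  count-expand x t [] = refl
  count-expand x t (u ∷ L) = begin
    count 𝒫 t (replicate (x u) u ++ expand x L)
      ≡⟨ count-++ t (replicate (x u) u) (expand x L) ⟩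
    count 𝒫 t (replicate (x u) u) + count 𝒫 t (expand x L)
      ≡⟨ cong₂ _+_ (count-replicate t (x u) u) (count-expand x t L) ⟩
    x u * count 𝒫 t [ u ] + count 𝒫 t L * x t
      ≡⟨ cong (_+ count 𝒫 t L * x t) (count-singleton-weight x t u) ⟩
    count 𝒫 t [ u ] * x t + count 𝒫 t L * x t
      ≡⟨ *-distribʳ-+ (x t) (count 𝒫 t [ u ]) (count 𝒫 t L) ⟨
    (count 𝒫 t [ u ] + count 𝒫 t L) * x t
      ≡⟨ cong (_* x t) (count-++ t [ u ] L) ⟨
    count 𝒫 t (u ∷ L) * x t ∎
    where open ≡-Reasoning

  count-expand-allTr : ∀ (x : Tr 𝒫 → ℕ) t → count 𝒫 t (expand x (allTr 𝒫)) ≡ x t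
  count-expand-allTr x t =
    trans (count-expand x t (allTr 𝒫)) (trans (cong (_* x t) (count-allTr t)) (*-identityˡ (x t)))

  data Shape : Key 𝒫 → Set where
    leader-sends    : ∀ a q s q′ s′ → Shape (a , inj₁ q , inj₁ s , inj₂ q′ , inj₂ s′)
    leader-receives : ∀ a q s q′ s′ → Shape (a , inj₂ q , inj₂ s , inj₁ q′ , inj₁ s′)
    followers-only  : ∀ a q s q′ s′ → Shape (a , inj₂ q , inj₂ s , inj₂ q′ , inj₂ s′)

  shape : ∀ κ → T (valid 𝒫 κ) → Shape κ
  shape (a , q , s , q′ , s′) v
    with sends , v′ ← Equivalence.to T-∧ v
    with receives , not-both-leader ← Equivalence.to T-∧ v′
    = classify q s q′ s′ sends receives not-both-leader
    where
    classify : ∀ q s q′ s′ → T (RuleIn 𝒫 q snd a s) → T (RuleIn 𝒫 q′ rcv a s′) →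
               T (not (isL 𝒫 q ∧ isL 𝒫 q′)) → Shape (a , q , s , q′ , s′)
    classify (inj₁ q) (inj₁ s) (inj₁ q′) (inj₁ s′) _ _ ()
    classify (inj₁ q) (inj₁ s) (inj₂ q′) (inj₂ s′) _ _ _ = leader-sends a q s q′ s′
    classify (inj₂ q) (inj₂ s) (inj₁ q′) (inj₁ s′) _ _ _ = leader-receives a q s q′ s′
    classify (inj₂ q) (inj₂ s) (inj₂ q′) (inj₂ s′) _ _ _ = followers-only a q s q′ s′
    classify (inj₁ _) (inj₂ _) _ _ () _ _
    classify (inj₂ _) (inj₁ _) _ _ () _ _
    classify (inj₁ _) (inj₁ _) (inj₁ _) (inj₂ _) _ () _
    classify (inj₁ _) (inj₁ _) (inj₂ _) (inj₁ _) _ () _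
    classify (inj₂ _) (inj₂ _) (inj₁ _) (inj₂ _) _ () _
    classify (inj₂ _) (inj₂ _) (inj₂ _) (inj₁ _) _ () _

  Pre-leader : ∀ j t → Pre 𝒫 (inj₁ j) t ≡ δsrc j (leaderEdge 𝒫 t)
  Pre-leader j (κ , v) with shape κ v
  ... | leader-sends _ _ _ _ _    = +-identityʳ _
  ... | leader-receives _ _ _ _ _ = refl
  ... | followers-only _ _ _ _ _  = refl

  Post-leader : ∀ j t → Post 𝒫 (inj₁ j) t ≡ δtgt j (leaderEdge 𝒫 t)
  Post-leader j (κ , v) with shape κ v
  ... | leader-sends _ _ _ _ _    = +-identityʳ _
  ... | leader-receives _ _ _ _ _ = refl
  ... | followers-only _ _ _ _ _  = refl

  ind≤1 : ∀ p q → ind 𝒫 p q ≤ 1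
  ind≤1 p q with does (_≟Q_ 𝒫 p q)
  ... | true  = ≤-refl
  ... | false = z≤n

  Pre≤2 : ∀ p t → Pre 𝒫 p t ≤ 2
  Pre≤2 p ((_ , q , _ , q′ , _) , _) = +-mono-≤ (ind≤1 p q) (ind≤1 p q′)

  LeaderAt : Marking 𝒫 → Fin nL → Set
  LeaderAt M ℓ = ∀ j → M (inj₁ j) ≡ δ j ℓ

  fire : Marking 𝒫 → Tr 𝒫 → Marking 𝒫
  fire M t p = M p ∸ Pre 𝒫 p t + Post 𝒫 p t

  fires : ∀ {M t} → (∀ p → Pre 𝒫 p t ≤ M p) → Fires 𝒫 M t (fire M t)
  fires {t = t} enabled = enabled , λ p → +[m∸n+o]≡m+[o-n] (Post 𝒫 p t) (enabled p)

  step-enabled : ∀ {M ℓ t v} → Step ℓ t v → LeaderAt M ℓ → (∀ q → 2 ≤ M (inj₂ q)) →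
                 ∀ p → Pre 𝒫 p t ≤ M p
  step-enabled {t = t} (move e) leader _ (inj₁ j) rewrite Pre-leader j t | e | leader j = ≤-refl
  step-enabled {t = t} (stay e) _      _ (inj₁ j) rewrite Pre-leader j t | e = z≤n
  step-enabled {t = t} _        _      two (inj₂ q) = ≤-trans (Pre≤2 (inj₂ q) t) (two q)

  step-leader : ∀ {M ℓ t v} → Step ℓ t v → LeaderAt M ℓ → LeaderAt (fire M t) v
  step-leader {ℓ = ℓ} {t} {v} (move e) leader j
    rewrite Pre-leader j t | Post-leader j t | e | leader j = cong (_+ δ j v) (n∸n≡0 (δ j ℓ))
  step-leader {ℓ = ℓ} {t} (stay e) leader j
    rewrite Pre-leader j t | Post-leader j t | e | leader j = +-identityʳ (δ j ℓ)

  fire-follower : ∀ M t q → M (inj₂ q) ∸ 2 ≤ fire M t (inj₂ q)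
  fire-follower M t q = ≤-trans (∸-monoʳ-≤ (M (inj₂ q)) (Pre≤2 (inj₂ q) t)) (m≤m+n _ _)

  walk⇒run : ∀ {M ℓ ξ e} → Walk ℓ ξ e → LeaderAt M ℓ → (∀ q → 2 * length ξ ≤ M (inj₂ q)) →
             ∃ λ D → Run 𝒫 M ξ D × LeaderAt D e
  walk⇒run {M} [] leader _ = M , done , leader
  walk⇒run {M} {ξ = t ∷ ξ} (s ∷ walk) leader enough =
    let D , run , leader-D = walk⇒run walk (step-leader {M} s leader) enough′
    in D , step {M' = fire M t} (fires {M} {t} (step-enabled {M} s leader two)) run , leader-D
    where
    two+ : ∀ q → 2 * length ξ + 2 ≤ M (inj₂ q)
    two+ q = subst (_≤ M (inj₂ q)) (trans (*-suc 2 (length ξ)) (+-comm 2 _)) (enough q)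
    two : ∀ q → 2 ≤ M (inj₂ q)
    two q = ≤-trans (m≤n+m 2 _) (two+ q)
    enough′ : ∀ q → 2 * length ξ ≤ fire M t (inj₂ q)
    enough′ q = ≤-trans (m+n≤o⇒m≤o∸n (2 * length ξ) (two+ q)) (fire-follower M t q)

  outDeg-expand : ∀ x j → outDeg (expand x (allTr 𝒫)) j ≡ weighted x (Pre 𝒫 (inj₁ j)) (allTr 𝒫)
  outDeg-expand x j = trans (sum-map-expand (δsrc j ∘ leaderEdge 𝒫) x (allTr 𝒫))
    (cong sum (List.map-cong (λ t → cong (x t *_) (sym (Pre-leader j t))) (allTr 𝒫)))

  inDeg-expand : ∀ x j → inDeg (expand x (allTr 𝒫)) j ≡ weighted x (Post 𝒫 (inj₁ j)) (allTr 𝒫)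
  inDeg-expand x j = trans (sum-map-expand (δtgt j ∘ leaderEdge 𝒫) x (allTr 𝒫))
    (cong sum (List.map-cong (λ t → cong (x t *_) (sym (Post-leader j t))) (allTr 𝒫)))

  balanced : ∀ {C x ℓ} → LeaderAt C ℓ → (∀ p → 0ℤ ℤ.≤ CplusAx 𝒫 C x p) →
             Balanced (expand x (allTr 𝒫)) ℓ
  balanced {C} {x} {ℓ} leader nonneg j =
    subst₂ _≤_ (sym (outDeg-expand x j)) (cong₂ _+_ (leader j) (sym (inDeg-expand x j)))
      (ℤ.drop‿+≤+ (ℤ.0≤i-j⇒j≤i (subst (0ℤ ℤ.≤_) C+Ax≡ (nonneg (inj₁ j)))))
    where
    C+Ax≡ : CplusAx 𝒫 C x (inj₁ j)
            ≡ ℤ.+ (C (inj₁ j) + weighted x (Post 𝒫 (inj₁ j)) (allTr 𝒫))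
              ℤ.- ℤ.+ weighted x (Pre 𝒫 (inj₁ j)) (allTr 𝒫)
    C+Ax≡ = foldr-weighted-difference x (Pre 𝒫 (inj₁ j)) (Post 𝒫 (inj₁ j)) (C (inj₁ j)) (allTr 𝒫)

  ∈-expand-allTr : ∀ {x t} → 0 < x t → t ∈ expand x (allTr 𝒫)
  ∈-expand-allTr {x} {t} pos = count-pos⇒∈ (subst (0 <_) (sym (count-expand-allTr x t)) pos)

  expand-allTr-∈ : ∀ {x t} → t ∈ expand x (allTr 𝒫) → 0 < x t
  expand-allTr-∈ {x} {t} t∈ = subst (0 <_) (count-expand-allTr x t) (∈⇒count-pos t∈)

  reach⇒reaches : ∀ {x ℓ v} → Reach 𝒫 x ℓ v → Reaches (expand x (allTr 𝒫)) ℓ v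
  reach⇒reaches here             = here
  reach⇒reaches (edge t pos e r) = via (∈-expand-allTr pos) e (reach⇒reaches r)

  sources-reachable : ∀ {C x ℓ} → Lead 𝒫 C ℓ → Compatible 𝒫 C x →
                      SourcesReachable (expand x (allTr 𝒫)) ℓ
  sources-reachable lead (_ , reach) t∈ e =
    reach⇒reaches (proj₁ (reach _ lead _ _ _ (expand-allTr-∈ t∈) e))

  IsConfig⇒LeaderAt : ∀ {C} → IsConfig 𝒫 C → ∃ (LeaderAt C)
  IsConfig⇒LeaderAt {C} isC = ∑≡1⇒indicator _ (trans (sym (sum-map-allFin (C ∘ inj₁))) isC)

  LeaderAt⇒IsConfig : ∀ {D ℓ} → LeaderAt D ℓ → IsConfig 𝒫 D
  LeaderAt⇒IsConfig {D} {ℓ} leader =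
    trans (sum-map-allFin (D ∘ inj₁)) (trans (sum-cong-≗ leader) (∑-δ ℓ))

  LeaderAt⇒Lead : ∀ {C ℓ} → LeaderAt C ℓ → Lead 𝒫 C ℓ
  LeaderAt⇒Lead {ℓ = ℓ} leader = subst (0 <_) (sym (trans (leader ℓ) (δ-refl ℓ))) (s≤s z≤n)

lemma7p8 : (𝒫 : LeaderProtocol) (C : Marking 𝒫) (x : Tr 𝒫 → ℕ) →
    IsConfig 𝒫 C → Compatible 𝒫 C x →
    (∀ (q : Fin (LeaderProtocol.nF 𝒫)) → C (inj₂ q) ≥ 2 * norm 𝒫 x) →
    Σ (Marking 𝒫) (λ D → Σ (List (Tr 𝒫)) (λ ξ →
      IsConfig 𝒫 D × Run 𝒫 C ξ D × Parikh≡ 𝒫 ξ x))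
lemma7p8 𝒫 C x isC compatible enough =
  let ℓ , leader = IsConfig⇒LeaderAt 𝒫 {C} isC
      ξ , _ , walk , X↭ξ =
        eulerian-walk (balanced 𝒫 {C} {x} leader (proj₁ compatible))
                      (sources-reachable 𝒫 {C} {x} (LeaderAt⇒Lead 𝒫 {C} leader) compatible)
      length-ξ = trans (sym (Perm.↭-length X↭ξ)) (length-expand x (allTr 𝒫))
      D , run , leader-D = walk⇒run 𝒫 {C} walk leader
                             (λ q → subst (λ m → 2 * m ≤ C (inj₂ q)) (sym length-ξ) (enough q))
  in D , ξ , LeaderAt⇒IsConfig 𝒫 {D} leader-D , run ,
     λ t → trans (count-↭ 𝒫 t (↭-sym X↭ξ)) (count-expand-allTr 𝒫 x t)
  where open Walks (leaderEdge 𝒫)
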